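{- Let $\alpha\in\Omega$. The following are equivalent: (1) $\alpha$ is settled (resp. strongly settled); (2) for all $n\ge1$, every $n$th descendant of $\alpha$ is settled (resp. strongly settled); (3) there exists $n\ge1$ such that every $n$th descendant of $\alpha$ is settled (resp. strongly settled).
   Context: $T$ is the rooted binary tree of finite words over $X=\{0,1\}$ (level $n$ = words of length $n$), $\Omega=\mathrm{Aut}(T)$ acting on the right with $(v)(\alpha\beta)=((v)\alpha)\beta$. Each $\alpha\in\Omega$ is uniquely $\alpha=(\alpha_0,\alpha_1)\tau$ with $\alpha_0,\alpha_1\in\Omega$, $\tau\in\{\mathrm{id},\sigma\}$ ($\sigma$ swaps $0,1$), meaning $(xv)\alpha=(x)\tau\,(v)\alpha_x$. Descendants: $\mathrm{Desc}_1(\alpha)=\{\alpha_0,\alpha_1\}$ if $\tau=\mathrm{id}$ and $\{\alpha_0\alpha_1\}$ if $\tau=\sigma$; for $n\ge2$, $\mathrm{Desc}_n(\alpha)=\bigcup_{\beta\in\mathrm{Desc}_{n-1}(\alpha)}\mathrm{Desc}_1(\beta)$; elements of $\mathrm{Desc}_n(\alpha)$ are the $n$th descendants. A vertex $v$ at level $n$ lies in a stable cycle of $\alpha$ of length $k$ if its $\alpha$-orbit has $k$ elements and for every $m>n$ the vertices at level $m$ above this orbit form a single $\alpha$-cycle of length $2^{m-n}k$. $s_n(\alpha)$ = number of such vertices at level $n$. $\alpha$ is settled if $s_n(\alpha)/2^n\to1$, and strongly settled if for some $n$ every vertex at level $n$ lies in a stable cycle of $\alpha$. -}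

module Defs where

open import Data.Bool using (Bool; true; false; _xor_)
open import Data.Nat using (ℕ; zero; suc; _*_; _^_; _≤_; _<_; _∸_; _+_)
open import Data.List using (List; []; _∷_; length; _++_)
open import Data.List.Relation.Unary.All using (All)
open import Data.List.Relation.Unary.Unique.Propositional using (Unique)
open import Data.Product using (Σ; ∃; _×_; _,_)
open import Function using (_⇔_)
open import Relation.Binary.PropositionalEquality using (_≡_; _≢_)

-- Vertices of the binary tree T: finite words over X = {0,1} (false = 0, true = 1).
-- Level n = words of length n.
Vertex : Set
Vertex = List Bool

-- An automorphism of T is represented by its portrait: the label at vertex v
-- is true iff the section of α at v acts as σ at its root.  Every α ∈ Aut(T)
-- is uniquely α = (α₀ , α₁) τ, with τ = σ iff (α []) ≡ true and α_x = section α x.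
Ω : Set
Ω = Vertex → Bool

root : Ω → Bool
root α = α []

section : Ω → Bool → Ω
section α x w = α (x ∷ w)

act : Vertex → Ω → Vertex
act [] α = []
act (x ∷ v) α = (x xor root α) ∷ act v (section α x)

-- product αβ (first α, then β):  (v)(αβ) = ((v)α)β
_·_ : Ω → Ω → Ω
(α · β) v = α v xor β (act v α)

actPow : Vertex → Ω → ℕ → Vertex
actPow v α zero = v
actPow v α (suc j) = act (actPow v α j) α

OrbitSize : Ω → Vertex → ℕ → Set
OrbitSize α v k =
  1 ≤ k × actPow v α k ≡ v × (∀ j → 1 ≤ j → j < k → actPow v α j ≢ v)

-- v (at level n = length v) lies in a stable cycle of α of length k:
-- its orbit has k elements and for every m > n (m = n + suc d) the vertices at
-- level m above this orbit (i.e. the words  (v)α^j ++ w  with length w = m - n)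
-- form a single α-cycle of length 2^(m-n) k, i.e. each of them has orbit of
-- exactly that size (the set has exactly 2^(m-n) k elements).
InStableCycleOfLength : Ω → Vertex → ℕ → Set
InStableCycleOfLength α v k =
  OrbitSize α v k ×
  (∀ d j (w : Vertex) → length w ≡ suc d →
     OrbitSize α (actPow v α j ++ w) (2 ^ suc d * k))

InStableCycle : Ω → Vertex → Set
InStableCycle α v = ∃ λ k → InStableCycleOfLength α v k

-- "s_n(α) ≥ c": there are at least c distinct vertices at level n lying in stable cycles.
AtLeastStable : Ω → ℕ → ℕ → Set
AtLeastStable α n c =
  Σ (List Vertex) λ L →
    Unique L × All (λ v → length v ≡ n × InStableCycle α v) L × c ≤ length L

-- α is settled: s_n(α)/2^n → 1.  Since s_n(α) ≤ 2^n, this means: for every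
-- k, eventually s_n(α)/2^n ≥ k/(k+1), i.e. k·2^n ≤ (k+1)·s_n(α).
Settled : Ω → Set
Settled α =
  ∀ k → ∃ λ N → ∀ n → N ≤ n →
    Σ ℕ λ c → AtLeastStable α n c × k * 2 ^ n ≤ suc k * c

StronglySettled : Ω → Set
StronglySettled α =
  ∃ λ n → ∀ (v : Vertex) → length v ≡ n → InStableCycle α v

data Desc₁ (α : Ω) : Ω → Set where
  desc-id₀ : root α ≡ false → Desc₁ α (section α false)
  desc-id₁ : root α ≡ false → Desc₁ α (section α true)
  desc-σ   : root α ≡ true  → Desc₁ α (section α false · section α true)

data Desc : ℕ → Ω → Ω → Set where
  desc-one  : ∀ {α β} → Desc₁ α β → Desc 1 α β
  desc-more : ∀ {n α β γ} → Desc (suc n) α β → Desc₁ β γ → Desc (suc (suc n)) α γ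

TFAE : (Ω → Set) → Ω → Set
TFAE P α =
  (P α ⇔ (∀ n → 1 ≤ n → ∀ β → Desc n α β → P β)) ×
  (P α ⇔ (∃ λ n → 1 ≤ n × (∀ β → Desc n α β → P β)))

-- If α fixes the root, α acts on the subtree below x as its section α_x.  If α
-- swaps the two subtrees, α² acts on the subtree below 0 as α₀α₁, and the
-- α-orbit of 0v is the α₀α₁-orbit of v interleaved with its image in the
-- subtree below 1, so it is twice as long.  Either way a vertex xv lies in a
-- stable cycle of α exactly when the corresponding level-n vertex lies in a
-- stable cycle of a first descendant; hence s_{n+1}(α) = s_n(α₀) + s_n(α₁),
-- resp. s_{n+1}(α) = 2 s_n(α₀α₁), and both settledness notions hold for α iff
-- they hold for all its first descendants.
module Submission where

open import Defs
open import Data.Bool as Bool using (Bool; true; false; _xor_)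
open import Data.Bool.Properties using (xor-assoc; xor-same; xor-identityʳ)
open import Data.List using (List; []; _∷_; length; _++_; map; take; drop)
open import Data.List.Properties
  using (∷-injectiveˡ; ∷-injectiveʳ; ++-assoc; ++-identityʳ; length-++; length-map; length-take; take++drop≡id)
open import Data.List.Membership.Propositional using (_∈_)
open import Data.List.Membership.Propositional.Properties using (∈-map⁻)
open import Data.List.Relation.Unary.All as All using (All; []; _∷_)
import Data.List.Relation.Unary.All.Properties as All
open import Data.List.Relation.Unary.AllPairs using ([]; _∷_)
open import Data.List.Relation.Unary.Unique.Propositional using (Unique)
import Data.List.Relation.Unary.Unique.Propositional.Properties as Unique
open import Data.Nat
open import Data.Nat.Properties
open import Data.Nat.Tactic.RingSolver using (solve-∀)
open import Data.Product using (Σ; ∃; ∃₂; _×_; _,_; proj₁; map₁; map₂; uncurry)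
open import Data.Sum using (_⊎_; inj₁; inj₂)
open import Function using (_∘_; _⇔_; mk⇔; Equivalence)
open import Function.Definitions using (Injective)
open import Relation.Binary.PropositionalEquality
open import Relation.Nullary using (¬_; contradiction; yes; no)

private
  variable
    α β : Ω
    u v : Vertex
    c d k m n : ℕ
    Q R : Vertex → Set
    P P′ : ℕ → Set

-- The action on vertices

xor-involutiveʳ : ∀ r x → (x xor r) xor r ≡ x
xor-involutiveʳ r x = trans (xor-assoc x r r) (trans (cong (x xor_) (xor-same r)) (xor-identityʳ x))

xor-cancelʳ : ∀ r {x y} → x xor r ≡ y xor r → x ≡ y
xor-cancelʳ r {x} {y} e =
  trans (sym (xor-involutiveʳ r x)) (trans (cong (_xor r) e) (xor-involutiveʳ r y))

act-length : ∀ v α → length (act v α) ≡ length v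
act-length []      α = refl
act-length (x ∷ v) α = cong suc (act-length v (section α x))

act-injective : ∀ α → Injective _≡_ _≡_ (λ v → act v α)
act-injective α {[]}    {[]}    _  = refl
act-injective α {x ∷ u} {y ∷ v} e with xor-cancelʳ (root α) {x} {y} (∷-injectiveˡ e)
... | refl = cong (x ∷_) (act-injective (section α x) (∷-injectiveʳ e))

act-· : ∀ v α β → act v (α · β) ≡ act (act v α) β
act-· []      α β = refl
act-· (x ∷ v) α β =
  cong₂ _∷_ (sym (xor-assoc x (root α) (root β)))
            (act-· v (section α x) (section β (x xor root α)))

sectionAt : Ω → Vertex → Ω
sectionAt α []      = α
sectionAt α (x ∷ u) = sectionAt (section α x) u

act-++ : ∀ u w α → act (u ++ w) α ≡ act u α ++ act w (sectionAt α u)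
act-++ []      w α = refl
act-++ (x ∷ u) w α = cong ((x xor root α) ∷_) (act-++ u w (section α x))

act-++-tail : ∀ u w α → ∃ λ w′ → act (u ++ w) α ≡ act u α ++ w′ × length w′ ≡ length w
act-++-tail u w α = act w (sectionAt α u) , act-++ u w α , act-length w _

actPow-++-tail : ∀ u w α j → ∃ λ w′ → actPow (u ++ w) α j ≡ actPow u α j ++ w′ × length w′ ≡ length w
actPow-++-tail u w α zero    = w , refl , refl
actPow-++-tail u w α (suc j) with actPow-++-tail u w α j
... | w′ , e , l with act-++-tail (actPow u α j) w′ α
...   | w″ , e′ , l′ = w″ , trans (cong (λ y → act y α) e) e′ , trans l′ l

actPow-act : ∀ v α j → actPow (act v α) α j ≡ act (actPow v α j) α
actPow-act v α zero    = refl
actPow-act v α (suc j) = cong (λ y → act y α) (actPow-act v α j)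

-- Orbits and stable cycles

module _ {V : Vertex} {f : Vertex → Vertex} (f-injective : Injective _≡_ _≡_ f)
         (orbit≡ : ∀ j → actPow V α j ≡ f (actPow v β j)) where

  orbitSize-transfer⁺ : OrbitSize β v k → OrbitSize α V k
  orbitSize-transfer⁺ {k} (1≤k , return , minimal) =
    1≤k ,
    trans (orbit≡ k) (trans (cong f return) (sym (orbit≡ 0))) ,
    λ j 1≤j j<k e → minimal j 1≤j j<k (f-injective (trans (sym (orbit≡ j)) (trans e (orbit≡ 0))))

  orbitSize-transfer⁻ : OrbitSize α V k → OrbitSize β v k
  orbitSize-transfer⁻ {k} (1≤k , return , minimal) =
    1≤k ,
    f-injective (trans (sym (orbit≡ k)) (trans return (orbit≡ 0))) ,
    λ j 1≤j j<k e → minimal j 1≤j j<k (trans (orbit≡ j) (trans (cong f e) (sym (orbit≡ 0))))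

orbitSize-act⁺ : OrbitSize α v k → OrbitSize α (act v α) k
orbitSize-act⁺ {α} {v} = orbitSize-transfer⁺ (act-injective α) (actPow-act v α)

orbitSize-act⁻ : OrbitSize α (act v α) k → OrbitSize α v k
orbitSize-act⁻ {α} {v} = orbitSize-transfer⁻ (act-injective α) (actPow-act v α)

CyclesAbove : Ω → Vertex → ℕ → ℕ → Set
CyclesAbove α u d m = ∀ w → length w ≡ d → OrbitSize α (u ++ w) m

StableAboveOrbit : Ω → Vertex → ℕ → Set
StableAboveOrbit α v k = ∀ d j → CyclesAbove α (actPow v α j) (suc d) (2 ^ suc d * k)

cyclesAbove-act⁻ : CyclesAbove α (act u α) d m → CyclesAbove α u d m
cyclesAbove-act⁻ {α} {u} cycles w l with act-++-tail u w α
... | w′ , e , l′ = orbitSize-act⁻ (subst (λ y → OrbitSize α y _) (sym e) (cycles w′ (trans l′ l)))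

inStableCycle-act⁺ : InStableCycle α v → InStableCycle α (act v α)
inStableCycle-act⁺ {α} {v} (k , orbit , stable) =
  k , orbitSize-act⁺ orbit ,
  λ d j → subst (λ y → CyclesAbove α y _ _) (sym (actPow-act v α j)) (stable d (suc j))

inStableCycle-act⁻ : InStableCycle α (act v α) → InStableCycle α v
inStableCycle-act⁻ {α} {v} (k , orbit , stable) =
  k , orbitSize-act⁻ orbit ,
  λ d j → cyclesAbove-act⁻ (subst (λ y → CyclesAbove α y _ _) (actPow-act v α j) (stable d j))

inStableCycle-++ : InStableCycle α v → ∀ w → InStableCycle α (v ++ w)
inStableCycle-++ {α} {v} s [] = subst (InStableCycle α) (sym (++-identityʳ v)) s
inStableCycle-++ {α} {v} (k , orbit , stable) w@(_ ∷ w₀) =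
  2 ^ length w * k , stable (length w₀) 0 w refl , stable′
  where
  size≡ : ∀ a b → a * b * k ≡ b * (a * k)
  size≡ a b = trans (cong (_* k) (*-comm a b)) (*-assoc b a k)

  stable′ : StableAboveOrbit α (v ++ w) (2 ^ length w * k)
  stable′ d j w′ l with actPow-++-tail v w α j
  ... | w″ , e , l″ =
    subst₂ (OrbitSize α)
      (trans (sym (++-assoc (actPow v α j) w″ w′)) (cong (_++ w′) (sym e)))
      (trans (cong (_* k) (^-distribˡ-+-* 2 (length w) (suc d))) (size≡ (2 ^ length w) (2 ^ suc d)))
      (stable (length w₀ + suc d) j (w″ ++ w′) (trans (length-++ w″) (cong₂ _+_ l″ l)))

AllStableAt : Ω → ℕ → Set
AllStableAt α n = ∀ v → length v ≡ n → InStableCycle α v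

allStableAt-mono : AllStableAt α n → n ≤ m → AllStableAt α m
allStableAt-mono {α} {n} allStable n≤m v refl =
  subst (InStableCycle α) (take++drop≡id n v)
    (inStableCycle-++ (allStable (take n v) (trans (length-take n v) (m≤n⇒m⊓n≡m n≤m))) (drop n v))

-- Counting vertices on a level

AtLeastOnLevel : (Vertex → Set) → ℕ → ℕ → Set
AtLeastOnLevel Q n c =
  Σ (List Vertex) λ L → Unique L × All (λ v → length v ≡ n × Q v) L × c ≤ length L

branch : Bool → List Vertex → List Vertex
branch b []               = []
branch b ([] ∷ L)         = branch b L
branch b ((x ∷ u) ∷ L) with x Bool.≟ b
... | yes _ = u ∷ branch b L
... | no  _ = branch b L

branch-All : ∀ b {L} → All Q L → All (Q ∘ (b ∷_)) (branch b L)
branch-All b {[]}          []       = []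
branch-All b {[] ∷ L}      (_ ∷ qs) = branch-All b qs
branch-All b {(x ∷ u) ∷ L} (q ∷ qs) with x Bool.≟ b
... | yes refl = q ∷ branch-All b qs
... | no  _    = branch-All b qs

branch-Unique : ∀ b {L} → Unique L → Unique (branch b L)
branch-Unique b {[]}          []       = []
branch-Unique b {[] ∷ L}      (_ ∷ us) = branch-Unique b us
branch-Unique b {(x ∷ u) ∷ L} (u∉ ∷ us) with x Bool.≟ b
... | yes refl = All.map (λ ≢ → ≢ ∘ cong (b ∷_)) (branch-All b u∉) ∷ branch-Unique b us
... | no  _    = branch-Unique b us

branch-length : ∀ {L} → All (λ v → length v ≡ suc n) L → length (branch false L) + length (branch true L) ≡ length L
branch-length {L = []}              []       = refl
branch-length {L = (false ∷ _) ∷ L} (_ ∷ ls) = cong suc (branch-length ls)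
branch-length {L = (true ∷ _) ∷ L}  (_ ∷ ls) = trans (+-suc _ _) (cong suc (branch-length ls))

unique-length-≤-2^ : ∀ n {L} → Unique L → All (λ v → length v ≡ n) L → length L ≤ 2 ^ n
unique-length-≤-2^ zero    {[]}               _             _            = z≤n
unique-length-≤-2^ zero    {[] ∷ []}          _             _            = ≤-refl
unique-length-≤-2^ zero    {[] ∷ [] ∷ _}      ((≢ ∷ _) ∷ _) _            = contradiction refl ≢
unique-length-≤-2^ zero    {[] ∷ (_ ∷ _) ∷ _} _             (_ ∷ () ∷ _)
unique-length-≤-2^ zero    {(_ ∷ _) ∷ _}      _             (() ∷ _)
unique-length-≤-2^ (suc n) {L}                unique        lengths      = begin
  length L                                             ≡⟨ branch-length lengths ⟨
  length (branch false L) + length (branch true L)     ≤⟨ +-mono-≤ (bound false) (bound true) ⟩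
  2 ^ n + 2 ^ n                                        ≡⟨ cong (2 ^ n +_) (+-identityʳ (2 ^ n)) ⟨
  2 ^ suc n                                            ∎
  where
  open ≤-Reasoning
  bound : ∀ b → length (branch b L) ≤ 2 ^ n
  bound b = unique-length-≤-2^ n (branch-Unique b unique) (All.map suc-injective (branch-All b lengths))

atLeastOnLevel-≤-2^ : AtLeastOnLevel Q n c → c ≤ 2 ^ n
atLeastOnLevel-≤-2^ {n = n} (L , unique , all , c≤) =
  ≤-trans c≤ (unique-length-≤-2^ n unique (All.map proj₁ all))

atLeastOnLevel-mono : (∀ {v} → Q v → R v) → AtLeastOnLevel Q n c → AtLeastOnLevel R n c
atLeastOnLevel-mono Q⇒R (L , unique , all , c≤) = L , unique , All.map (map₂ Q⇒R) all , c≤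

atLeastOnLevel-map : ∀ {f} → Injective _≡_ _≡_ f → (∀ v → length (f v) ≡ length v) →
                     (∀ {v} → Q v → R (f v)) → AtLeastOnLevel Q n c → AtLeastOnLevel R n c
atLeastOnLevel-map {c = c} {f} f-injective f-length Q⇒R (L , unique , all , c≤) =
  map f L ,
  Unique.map⁺ f-injective unique ,
  All.map⁺ (All.map (λ {v} (l , q) → trans (f-length v) l , Q⇒R q) all) ,
  subst (c ≤_) (sym (length-map f L)) c≤

atLeastOnLevel-⊔ : AtLeastOnLevel Q n c → AtLeastOnLevel Q n m → AtLeastOnLevel Q n (c ⊔ m)
atLeastOnLevel-⊔ {c = c} {m = m} atLeast₁ atLeast₂ with ⊔-sel c m
... | inj₁ c⊔m≡c = subst (AtLeastOnLevel _ _) (sym c⊔m≡c) atLeast₁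
... | inj₂ c⊔m≡m = subst (AtLeastOnLevel _ _) (sym c⊔m≡m) atLeast₂

atLeastOnLevel-split : AtLeastOnLevel Q (suc n) c →
  ∃₂ λ c₀ c₁ → AtLeastOnLevel (Q ∘ (false ∷_)) n c₀ × AtLeastOnLevel (Q ∘ (true ∷_)) n c₁ × c ≤ c₀ + c₁
atLeastOnLevel-split {Q} {n} (L , unique , all , c≤) =
  _ , _ , onBranch false , onBranch true ,
  ≤-trans c≤ (≤-reflexive (sym (branch-length (All.map proj₁ all))))
  where
  onBranch : ∀ b → AtLeastOnLevel (Q ∘ (b ∷_)) n (length (branch b L))
  onBranch b = branch b L , branch-Unique b unique , All.map (map₁ suc-injective) (branch-All b all) , ≤-refl

atLeastOnLevel-join : AtLeastOnLevel (Q ∘ (false ∷_)) n c → AtLeastOnLevel (Q ∘ (true ∷_)) n m →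
                      AtLeastOnLevel Q (suc n) (c + m)
atLeastOnLevel-join {c = c} {m = m} (L₀ , unique₀ , all₀ , c≤) (L₁ , unique₁ , all₁ , m≤) =
  map (false ∷_) L₀ ++ map (true ∷_) L₁ ,
  Unique.++⁺ (Unique.map⁺ ∷-injectiveʳ unique₀) (Unique.map⁺ ∷-injectiveʳ unique₁) disjoint ,
  All.++⁺ (All.map⁺ (All.map (map₁ (cong suc)) all₀)) (All.map⁺ (All.map (map₁ (cong suc)) all₁)) ,
  subst (c + m ≤_) (sym (trans (length-++ (map (false ∷_) L₀)) (cong₂ _+_ (length-map _ L₀) (length-map _ L₁))))
        (+-mono-≤ c≤ m≤)
  where
  disjoint : ∀ {v} → ¬ (v ∈ map (false ∷_) L₀ × v ∈ map (true ∷_) L₁)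
  disjoint (∈₀ , ∈₁) with ∈-map⁻ (false ∷_) ∈₀ | ∈-map⁻ (true ∷_) ∈₁
  ... | _ , _ , refl | _ , _ , ()

*-double : ∀ a k → a * (2 * k) ≡ 2 * (a * k)
*-double = solve-∀

fraction-+ : ∀ k s x a b → k * x ≤ s * a → k * x ≤ s * b → k * (2 * x) ≤ s * (a + b)
fraction-+ k s x a b ka kb = begin
  k * (2 * x)       ≡⟨ double≡ k x ⟩
  k * x + k * x     ≤⟨ +-mono-≤ ka kb ⟩
  s * a + s * b     ≡⟨ *-distribˡ-+ s a b ⟨
  s * (a + b)       ∎
  where
  open ≤-Reasoning
  double≡ : ∀ k x → k * (2 * x) ≡ k * x + k * x
  double≡ = solve-∀

fraction-half : ∀ k s x c m → k * (2 * x) ≤ s * c → c ≤ m + m → k * x ≤ s * m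
fraction-half k s x c m frac c≤m+m = *-cancelˡ-≤ 2 (begin
  2 * (k * x)       ≡⟨ *-double k x ⟨
  k * (2 * x)       ≤⟨ frac ⟩
  s * c             ≤⟨ *-monoʳ-≤ s c≤m+m ⟩
  s * (m + m)       ≡⟨ double≡ s m ⟩
  2 * (s * m)       ∎)
  where
  open ≤-Reasoning
  double≡ : ∀ s m → s * (m + m) ≡ 2 * (s * m)
  double≡ = solve-∀

-- The fraction (2k+1)/(2k+2) is chosen so that, after discarding the other
-- branch (at most half of the level), a fraction k/(k+1) of this branch remains.
fraction-branch : ∀ k x c a b → (k + suc k) * (2 * x) ≤ suc (k + suc k) * c → c ≤ a + b → b ≤ x →
                  k * x ≤ suc k * a
fraction-branch k x c a b frac c≤a+b b≤x = +-cancelʳ-≤ (suc k * x) (k * x) (suc k * a) (begin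
  k * x + suc k * x       ≤⟨ *-cancelˡ-≤ 2 (subst₂ _≤_ (lhs≡ k x) (rhs≡ k c) frac) ⟩
  suc k * c               ≤⟨ *-monoʳ-≤ (suc k) c≤a+b ⟩
  suc k * (a + b)         ≡⟨ *-distribˡ-+ (suc k) a b ⟩
  suc k * a + suc k * b   ≤⟨ +-monoʳ-≤ (suc k * a) (*-monoʳ-≤ (suc k) b≤x) ⟩
  suc k * a + suc k * x   ∎)
  where
  open ≤-Reasoning
  lhs≡ : ∀ k x → (k + suc k) * (2 * x) ≡ 2 * (k * x + suc k * x)
  lhs≡ = solve-∀
  rhs≡ : ∀ k c → suc (k + suc k) * c ≡ 2 * (suc k * c)
  rhs≡ = solve-∀

Eventually : (ℕ → Set) → Set
Eventually P = ∃ λ N → ∀ n → N ≤ n → P n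

eventually-map : (∀ {n} → P n → P′ n) → Eventually P → Eventually P′
eventually-map f (N , h) = N , λ n N≤n → f (h n N≤n)

eventually-suc⁺ : Eventually P → Eventually (P ∘ suc)
eventually-suc⁺ (N , h) = N , λ n N≤n → h (suc n) (m≤n⇒m≤1+n N≤n)

eventually-suc⁻ : Eventually (P ∘ suc) → Eventually P
eventually-suc⁻ (N , h) = suc N , λ { (suc n) (s≤s N≤n) → h n N≤n }

eventually-× : Eventually P → Eventually P′ → Eventually (λ n → P n × P′ n)
eventually-× (N , h) (N′ , h′) =
  N ⊔ N′ , λ n N⊔N′≤n → h n (m⊔n≤o⇒m≤o N N′ N⊔N′≤n) , h′ n (m⊔n≤o⇒n≤o N N′ N⊔N′≤n)

StableFraction : Ω → ℕ → ℕ → Set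
StableFraction α k n = Σ ℕ λ c → AtLeastStable α n c × k * 2 ^ n ≤ suc k * c

-- First descendants

module RootFixed (fixed : root α ≡ false) where

  actPow-section : ∀ x v j → actPow (x ∷ v) α j ≡ x ∷ actPow v (section α x) j
  actPow-section x v zero    = refl
  actPow-section x v (suc j) =
    trans (cong (λ y → act y α) (actPow-section x v j))
          (cong₂ _∷_ (trans (cong (x xor_) fixed) (xor-identityʳ x)) refl)

  orbitSize-section⁺ : ∀ x → OrbitSize (section α x) v k → OrbitSize α (x ∷ v) k
  orbitSize-section⁺ {v} x = orbitSize-transfer⁺ ∷-injectiveʳ (actPow-section x v)

  orbitSize-section⁻ : ∀ x → OrbitSize α (x ∷ v) k → OrbitSize (section α x) v k
  orbitSize-section⁻ {v} x = orbitSize-transfer⁻ ∷-injectiveʳ (actPow-section x v)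

  inStableCycle-section⁺ : ∀ x → InStableCycle (section α x) v → InStableCycle α (x ∷ v)
  inStableCycle-section⁺ {v} x (k , orbit , stable) =
    k , orbitSize-section⁺ x orbit ,
    λ d j w l → subst (λ y → OrbitSize α (y ++ w) _) (sym (actPow-section x v j))
                      (orbitSize-section⁺ x (stable d j w l))

  inStableCycle-section⁻ : ∀ x → InStableCycle α (x ∷ v) → InStableCycle (section α x) v
  inStableCycle-section⁻ {v} x (k , orbit , stable) =
    k , orbitSize-section⁻ x orbit ,
    λ d j w l → orbitSize-section⁻ x
                  (subst (λ y → OrbitSize α (y ++ w) _) (actPow-section x v j) (stable d j w l))

  allStableAt-section : ∀ x → AllStableAt α (suc n) → AllStableAt (section α x) n
  allStableAt-section x allStable v l = inStableCycle-section⁻ x (allStable (x ∷ v) (cong suc l))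

  allStableAt-sections : AllStableAt (section α false) n → AllStableAt (section α true) n → AllStableAt α (suc n)
  allStableAt-sections allStable₀ allStable₁ (false ∷ v) l = inStableCycle-section⁺ false (allStable₀ v (suc-injective l))
  allStableAt-sections allStable₀ allStable₁ (true ∷ v)  l = inStableCycle-section⁺ true (allStable₁ v (suc-injective l))

  stableFraction-section : ∀ x → StableFraction α (k + suc k) (suc n) → StableFraction (section α x) k n
  stableFraction-section {k} {n} x (c , atLeast , frac) with x | atLeastOnLevel-split atLeast
  ... | false | c₀ , c₁ , atLeast₀ , atLeast₁ , c≤ =
    c₀ , atLeastOnLevel-mono (inStableCycle-section⁻ false) atLeast₀ ,
    fraction-branch k (2 ^ n) c c₀ c₁ frac c≤ (atLeastOnLevel-≤-2^ atLeast₁)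
  ... | true  | c₀ , c₁ , atLeast₀ , atLeast₁ , c≤ =
    c₁ , atLeastOnLevel-mono (inStableCycle-section⁻ true) atLeast₁ ,
    fraction-branch k (2 ^ n) c c₁ c₀ frac (≤-trans c≤ (≤-reflexive (+-comm c₀ c₁))) (atLeastOnLevel-≤-2^ atLeast₀)

  stableFraction-sections : StableFraction (section α false) k n → StableFraction (section α true) k n →
                            StableFraction α k (suc n)
  stableFraction-sections {k} {n} (c₀ , atLeast₀ , frac₀) (c₁ , atLeast₁ , frac₁) =
    c₀ + c₁ ,
    atLeastOnLevel-join (atLeastOnLevel-mono (inStableCycle-section⁺ false) atLeast₀)
                        (atLeastOnLevel-mono (inStableCycle-section⁺ true) atLeast₁) ,
    fraction-+ k (suc k) (2 ^ n) c₀ c₁ frac₀ frac₁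

  settled-section : Settled α → ∀ x → Settled (section α x)
  settled-section settled x k =
    eventually-map (stableFraction-section {k = k} x) (eventually-suc⁺ (settled (k + suc k)))

  settled-sections : Settled (section α false) → Settled (section α true) → Settled α
  settled-sections settled₀ settled₁ k =
    eventually-suc⁻ (eventually-map (uncurry (stableFraction-sections {k = k})) (eventually-× (settled₀ k) (settled₁ k)))

  stronglySettled-section : StronglySettled α → ∀ x → StronglySettled (section α x)
  stronglySettled-section (n , allStable) x = n , allStableAt-section x (allStableAt-mono allStable (n≤1+n n))

  stronglySettled-sections : StronglySettled (section α false) → StronglySettled (section α true) → StronglySettled α
  stronglySettled-sections (n₀ , allStable₀) (n₁ , allStable₁) =
    suc (n₀ ⊔ n₁) ,
    allStableAt-sections (allStableAt-mono allStable₀ (m≤m⊔n n₀ n₁)) (allStableAt-mono allStable₁ (m≤n⊔m n₀ n₁))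

sectionProduct : Ω → Ω
sectionProduct α = section α false · section α true

even-or-odd : ∀ j → ∃ λ i → j ≡ 2 * i ⊎ j ≡ suc (2 * i)
even-or-odd zero          = 0 , inj₁ refl
even-or-odd (suc zero)    = 0 , inj₂ refl
even-or-odd (suc (suc j)) with even-or-odd j
... | i , inj₁ refl = suc i , inj₁ (sym (*-suc 2 i))
... | i , inj₂ refl = suc i , inj₂ (cong suc (sym (*-suc 2 i)))

module RootSwapped (swapped : root α ≡ true) where

  private
    γ : Ω
    γ = sectionProduct α

  act-false∷ : ∀ u → act (false ∷ u) α ≡ true ∷ act u (section α false)
  act-false∷ u = cong₂ _∷_ swapped refl

  act-true∷ : ∀ u → act (true ∷ u) α ≡ false ∷ act u (section α true)
  act-true∷ u = cong₂ _∷_ (cong (true xor_) swapped) refl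

  act²-false∷ : ∀ u → act (act (false ∷ u) α) α ≡ false ∷ act u γ
  act²-false∷ u =
    trans (cong (λ y → act y α) (act-false∷ u))
          (trans (act-true∷ _) (cong (false ∷_) (sym (act-· u (section α false) (section α true)))))

  actPow-even : ∀ v i → actPow (false ∷ v) α (2 * i) ≡ false ∷ actPow v γ i
  actPow-even v zero    = refl
  actPow-even v (suc i) = begin
    actPow (false ∷ v) α (2 * suc i)                ≡⟨ cong (actPow (false ∷ v) α) (*-suc 2 i) ⟩
    act (act (actPow (false ∷ v) α (2 * i)) α) α    ≡⟨ cong (λ y → act (act y α) α) (actPow-even v i) ⟩
    act (act (false ∷ actPow v γ i) α) α            ≡⟨ act²-false∷ (actPow v γ i) ⟩
    false ∷ actPow v γ (suc i)                      ∎
    where open ≡-Reasoning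

  actPow-odd : ∀ v i → actPow (false ∷ v) α (suc (2 * i)) ≡ true ∷ act (actPow v γ i) (section α false)
  actPow-odd v i = trans (cong (λ y → act y α) (actPow-even v i)) (act-false∷ _)

  actPow-odd≢false∷ : ∀ v i → actPow (false ∷ v) α (suc (2 * i)) ≢ false ∷ u
  actPow-odd≢false∷ v i e with ∷-injectiveˡ (trans (sym (actPow-odd v i)) e)
  ... | ()

  orbitSize-even : OrbitSize α (false ∷ v) m → ∃ λ k → m ≡ 2 * k
  orbitSize-even {v} {m} (_ , return , _) with even-or-odd m
  ... | k , inj₁ m≡2k = k , m≡2k
  ... | k , inj₂ refl = contradiction return (actPow-odd≢false∷ v k)

  orbitSize-sectionProduct⁺ : OrbitSize γ v k → OrbitSize α (false ∷ v) (2 * k)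
  orbitSize-sectionProduct⁺ {v} {k} (1≤k , return , minimal) =
    *-monoʳ-< 2 1≤k , trans (actPow-even v k) (cong (false ∷_) return) , minimal′
    where
    minimal′ : ∀ j → 1 ≤ j → j < 2 * k → actPow (false ∷ v) α j ≢ false ∷ v
    minimal′ j 1≤j j<2k with even-or-odd j
    ... | i , inj₁ refl = λ e →
      minimal i (*-cancelˡ-< 2 0 i 1≤j) (*-cancelˡ-< 2 i k j<2k) (∷-injectiveʳ (trans (sym (actPow-even v i)) e))
    ... | i , inj₂ refl = actPow-odd≢false∷ v i

  orbitSize-sectionProduct⁻ : OrbitSize α (false ∷ v) (2 * k) → OrbitSize γ v k
  orbitSize-sectionProduct⁻ {v} {k} (1≤2k , return , minimal) =
    *-cancelˡ-< 2 0 k 1≤2k ,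
    ∷-injectiveʳ (trans (sym (actPow-even v k)) return) ,
    λ i 1≤i i<k e →
      minimal (2 * i) (*-monoʳ-< 2 1≤i) (*-monoʳ-< 2 i<k) (trans (actPow-even v i) (cong (false ∷_) e))

  inStableCycleOfLength-sectionProduct⁻ :
    InStableCycleOfLength α (false ∷ v) (2 * k) → InStableCycleOfLength γ v k
  inStableCycleOfLength-sectionProduct⁻ {v} {k} (orbit , stable) =
    orbitSize-sectionProduct⁻ orbit ,
    λ d j w l → orbitSize-sectionProduct⁻
      (subst₂ (λ y m → OrbitSize α (y ++ w) m) (actPow-even v j) (*-double (2 ^ suc d) k) (stable d (2 * j) w l))

  -- Odd positions of the α-orbit lie in the subtree below 1; one more step of α
  -- brings them back to an even position, and orbit sizes are invariant under α.
  inStableCycleOfLength-sectionProduct⁺ :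
    InStableCycleOfLength γ v k → InStableCycleOfLength α (false ∷ v) (2 * k)
  inStableCycleOfLength-sectionProduct⁺ {v} {k} (orbit , stable) =
    orbitSize-sectionProduct⁺ orbit , stable′
    where
    even : ∀ d i → CyclesAbove α (actPow (false ∷ v) α (2 * i)) (suc d) (2 ^ suc d * (2 * k))
    even d i w l =
      subst₂ (λ y m → OrbitSize α (y ++ w) m) (sym (actPow-even v i)) (sym (*-double (2 ^ suc d) k))
        (orbitSize-sectionProduct⁺ (stable d i w l))

    stable′ : StableAboveOrbit α (false ∷ v) (2 * k)
    stable′ d j with even-or-odd j
    ... | i , inj₁ refl = even d i
    ... | i , inj₂ refl = cyclesAbove-act⁻
      (subst (λ y → CyclesAbove α y _ _) (cong (actPow (false ∷ v) α) (*-suc 2 i)) (even d (suc i)))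

  inStableCycle-sectionProduct⁺ : InStableCycle γ v → InStableCycle α (false ∷ v)
  inStableCycle-sectionProduct⁺ (k , s) = 2 * k , inStableCycleOfLength-sectionProduct⁺ s

  inStableCycle-sectionProduct⁻ : InStableCycle α (false ∷ v) → InStableCycle γ v
  inStableCycle-sectionProduct⁻ (m , s) with orbitSize-even (proj₁ s)
  ... | k , refl = k , inStableCycleOfLength-sectionProduct⁻ s

  inStableCycle-true∷⁺ : InStableCycle γ (act u (section α true)) → InStableCycle α (true ∷ u)
  inStableCycle-true∷⁺ {u} s =
    inStableCycle-act⁻ (subst (InStableCycle α) (sym (act-true∷ u)) (inStableCycle-sectionProduct⁺ s))

  inStableCycle-true∷⁻ : InStableCycle α (true ∷ u) → InStableCycle γ (act u (section α true))
  inStableCycle-true∷⁻ {u} s =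
    inStableCycle-sectionProduct⁻ (subst (InStableCycle α) (act-true∷ u) (inStableCycle-act⁺ s))

  allStableAt-sectionProduct⁻ : AllStableAt α (suc n) → AllStableAt γ n
  allStableAt-sectionProduct⁻ allStable v l = inStableCycle-sectionProduct⁻ (allStable (false ∷ v) (cong suc l))

  allStableAt-sectionProduct⁺ : AllStableAt γ n → AllStableAt α (suc n)
  allStableAt-sectionProduct⁺ allStable (false ∷ v) l = inStableCycle-sectionProduct⁺ (allStable v (suc-injective l))
  allStableAt-sectionProduct⁺ allStable (true ∷ u)  l =
    inStableCycle-true∷⁺ (allStable (act u (section α true)) (trans (act-length u _) (suc-injective l)))

  stableFraction-sectionProduct⁻ : StableFraction α k (suc n) → StableFraction γ k n
  stableFraction-sectionProduct⁻ {k} {n} (c , atLeast , frac) with atLeastOnLevel-split atLeast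
  ... | c₀ , c₁ , atLeast₀ , atLeast₁ , c≤ =
    c₀ ⊔ c₁ ,
    atLeastOnLevel-⊔ (atLeastOnLevel-mono inStableCycle-sectionProduct⁻ atLeast₀)
                     (atLeastOnLevel-map (act-injective (section α true)) (λ u → act-length u _)
                                         inStableCycle-true∷⁻ atLeast₁) ,
    fraction-half k (suc k) (2 ^ n) c (c₀ ⊔ c₁) frac (≤-trans c≤ (+-mono-≤ (m≤m⊔n c₀ c₁) (m≤n⊔m c₀ c₁)))

  stableFraction-sectionProduct⁺ : StableFraction γ k n → StableFraction α k (suc n)
  stableFraction-sectionProduct⁺ {k} {n} (c , atLeast , frac) =
    c + c ,
    atLeastOnLevel-join (atLeastOnLevel-mono inStableCycle-sectionProduct⁺ atLeast)
                        (atLeastOnLevel-map (act-injective (section α false)) (λ v → act-length v _)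
                                            stable-true∷ atLeast) ,
    fraction-+ k (suc k) (2 ^ n) c c frac frac
    where
    stable-true∷ : InStableCycle γ v → InStableCycle α (true ∷ act v (section α false))
    stable-true∷ {v} s =
      inStableCycle-true∷⁺ (subst (InStableCycle γ) (act-· v (section α false) (section α true)) (inStableCycle-act⁺ s))

  settled-sectionProduct⁻ : Settled α → Settled γ
  settled-sectionProduct⁻ settled k =
    eventually-map (stableFraction-sectionProduct⁻ {k = k}) (eventually-suc⁺ (settled k))

  settled-sectionProduct⁺ : Settled γ → Settled α
  settled-sectionProduct⁺ settled k =
    eventually-suc⁻ (eventually-map (stableFraction-sectionProduct⁺ {k = k}) (settled k))

  stronglySettled-sectionProduct⁻ : StronglySettled α → StronglySettled γ
  stronglySettled-sectionProduct⁻ (n , allStable) =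
    n , allStableAt-sectionProduct⁻ (allStableAt-mono allStable (n≤1+n n))

  stronglySettled-sectionProduct⁺ : StronglySettled γ → StronglySettled α
  stronglySettled-sectionProduct⁺ (n , allStable) = suc n , allStableAt-sectionProduct⁺ allStable

DeterminedByDescendants : (Ω → Set) → Set
DeterminedByDescendants P = ∀ α → P α ⇔ (∀ β → Desc₁ α β → P β)

settled-determinedByDescendants : DeterminedByDescendants Settled
settled-determinedByDescendants α = mk⇔ to from
  where
  to : Settled α → ∀ β → Desc₁ α β → Settled β
  to settled _ (desc-id₀ fixed)  = RootFixed.settled-section fixed settled false
  to settled _ (desc-id₁ fixed)  = RootFixed.settled-section fixed settled true
  to settled _ (desc-σ swapped)  = RootSwapped.settled-sectionProduct⁻ swapped settled

  from : (∀ β → Desc₁ α β → Settled β) → Settled α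
  from descendants with root α in eq
  ... | false = RootFixed.settled-sections eq (descendants _ (desc-id₀ eq)) (descendants _ (desc-id₁ eq))
  ... | true  = RootSwapped.settled-sectionProduct⁺ eq (descendants _ (desc-σ eq))

stronglySettled-determinedByDescendants : DeterminedByDescendants StronglySettled
stronglySettled-determinedByDescendants α = mk⇔ to from
  where
  to : StronglySettled α → ∀ β → Desc₁ α β → StronglySettled β
  to strong _ (desc-id₀ fixed)  = RootFixed.stronglySettled-section fixed strong false
  to strong _ (desc-id₁ fixed)  = RootFixed.stronglySettled-section fixed strong true
  to strong _ (desc-σ swapped)  = RootSwapped.stronglySettled-sectionProduct⁻ swapped strong

  from : (∀ β → Desc₁ α β → StronglySettled β) → StronglySettled α
  from descendants with root α in eq
  ... | false = RootFixed.stronglySettled-sections eq (descendants _ (desc-id₀ eq)) (descendants _ (desc-id₁ eq))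
  ... | true  = RootSwapped.stronglySettled-sectionProduct⁺ eq (descendants _ (desc-σ eq))

module _ {P : Ω → Set} (determined : DeterminedByDescendants P) where

  desc-preserves : P α → Desc n α β → P β
  desc-preserves p (desc-one d)     = Equivalence.to (determined _) p _ d
  desc-preserves p (desc-more ds d) = Equivalence.to (determined _) (desc-preserves p ds) _ d

  desc-reflects : ∀ n → (∀ β → Desc (suc n) α β → P β) → P α
  desc-reflects zero    descendants = Equivalence.from (determined _) λ β d → descendants β (desc-one d)
  desc-reflects (suc n) descendants =
    desc-reflects n λ β ds → Equivalence.from (determined β) λ γ d → descendants γ (desc-more ds d)

  tfae : ∀ α → TFAE P α
  tfae α =
    mk⇔ (λ p → λ { (suc n) _ β → desc-preserves p }) (λ descendants → desc-reflects 0 (descendants 1 ≤-refl)) ,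
    mk⇔ (λ p → 1 , ≤-refl , λ β → desc-preserves p) (λ { (suc n , _ , descendants) → desc-reflects n descendants })

theorem3p9 : (α : Ω) → TFAE Settled α × TFAE StronglySettled α
theorem3p9 α = tfae settled-determinedByDescendants α , tfae stronglySettled-determinedByDescendants α
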